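{- If $F_1$ and $F_2$ are two maximal hke collections with $\alpha(F_1)=\alpha(F_2)$, then $F_1$ and $F_2$ are isomorphic.
   Context: All collections are non-empty finite collections of finite sets. A collection $F$ is an \emph{hke collection} if there is a positive integer $\alpha$ such that $|\bigcup \Gamma|+|\bigcap \Gamma|=2\alpha$ for every non-empty subcollection $\Gamma\subseteq F$; this $\alpha$ is denoted $\alpha(F)$. An hke collection $F$ is \emph{maximal} if there is no hke collection $F'$ with $F\subsetneq F'$. Two collections $F_1,F_2$ are \emph{isomorphic} if there is a bijection $g:\bigcup F_1\to\bigcup F_2$ such that $g[S]\in F_2$ for every $S\in F_1$ and $g^{ -1}[S]\in F_1$ for every $S\in F_2$. -}

module Defs where

open import Data.Nat using (ℕ; _+_; _*_; _<_; _≟_)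
open import Data.Bool using (Bool)
open import Data.List using (List; []; _∷_; length; filter; concatMap; deduplicate)
open import Data.List.NonEmpty using (List⁺; _∷_; toList)
open import Data.List.Relation.Unary.Linked using (Linked)
open import Data.List.Relation.Unary.All using (All; all?)
open import Data.List.Relation.Unary.Any using (Any)
open import Data.List.Membership.Propositional using (_∈_; _∉_)
open import Data.List.Membership.DecPropositional _≟_ using (_∈?_)
open import Data.Product using (Σ; ∃; ∃-syntax; _×_; _,_; proj₁)
open import Relation.Nullary using (¬_)
open import Relation.Binary.PropositionalEquality using (_≡_)
open import Function.Bundles using (_⇔_)

-- A finite set (of natural numbers), in canonical form:
-- a strictly increasing list of its elements.
FinSet : Set
FinSet = Σ (List ℕ) (Linked _<_)

_∈ₛ_ : ℕ → FinSet → Set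
x ∈ₛ S = x ∈ proj₁ S

-- A collection: a non-empty finite collection of finite sets
-- (a non-empty list; repetitions are irrelevant, only membership matters).
Collection : Set
Collection = List⁺ FinSet

_∈ᶜ_ : FinSet → Collection → Set
S ∈ᶜ F = S ∈ toList F

_⊆ᶜ_ : Collection → Collection → Set
Γ ⊆ᶜ F = All (λ S → S ∈ᶜ F) (toList Γ)

unionSize : Collection → ℕ
unionSize Γ = length (deduplicate _≟_ (concatMap proj₁ (toList Γ)))

interSize : Collection → ℕ
interSize (S ∷ Γ) = length (filter (λ x → all? (λ T → x ∈? proj₁ T) Γ) (proj₁ S))

IsHKE : Collection → ℕ → Set
IsHKE F α = (0 < α) × (∀ (Γ : Collection) → Γ ⊆ᶜ F → unionSize Γ + interSize Γ ≡ 2 * α)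

HKE : Collection → Set
HKE F = ∃[ α ] IsHKE F α

_⊊ᶜ_ : Collection → Collection → Set
F ⊊ᶜ F' = (F ⊆ᶜ F') × (∃[ S ] (S ∈ᶜ F' × ¬ (S ∈ᶜ F)))

Maximal : Collection → Set
Maximal F = HKE F × ¬ (∃[ F' ] (HKE F' × F ⊊ᶜ F'))

_∈⋃_ : ℕ → Collection → Set
x ∈⋃ F = ∃[ S ] (S ∈ᶜ F × x ∈ₛ S)

record Isomorphic (F₁ F₂ : Collection) : Set where
  field
    g        : ℕ → ℕ
    maps     : ∀ x → x ∈⋃ F₁ → g x ∈⋃ F₂
    injective : ∀ x y → x ∈⋃ F₁ → y ∈⋃ F₁ → g x ≡ g y → x ≡ y
    surjective : ∀ y → y ∈⋃ F₂ → ∃[ x ] (x ∈⋃ F₁ × g x ≡ y)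
    image    : ∀ S → S ∈ᶜ F₁ →
                 ∃[ T ] (T ∈ᶜ F₂ × (∀ y → y ∈ₛ T ⇔ (∃[ x ] (x ∈ₛ S × g x ≡ y))))
    preimage : ∀ S → S ∈ᶜ F₂ →
                 ∃[ T ] (T ∈ᶜ F₁ × (∀ x → x ∈⋃ F₁ → (x ∈ₛ T ⇔ g x ∈ₛ S)))

module Submission where

-- Describe a collection F = S₁, …, Sₙ through the pattern P e = (e ∈ S₁, …, e ∈ Sₙ)
-- of each point e of ⋃F.  For the subcollection Γ selected by a nonzero vector w,
-- |⋂Γ| counts the points with w ⊆ P e and |⋃Γ| = |⋃F| - #{e | w ⊆ complement (P e)}.
-- Möbius inversion on the Boolean lattice (upset-counts-determine) turns the hke
-- condition into a criterion (module Criterion): F is hke with parameter α iff the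
-- multiset of non-full patterns is closed under complementation and
-- (number of points in every set) + |⋃F| = 2α.  For a maximal F, adding a suitable
-- new set would preserve the criterion unless (module MaximalStructure): no point is
-- in every set, distinct points have distinct patterns, and F contains every
-- transversal of the involution σ pairing each point with the point of complementary
-- pattern.  So F is a transversal family whose members all have α elements, and two
-- such families with equal α are isomorphic by matching their first members position
-- by position and extending the matching through the involutions (module Matching).

open import Defs

open import Data.Nat using (ℕ; zero; suc; _+_; _*_; _<_; z≤n; s≤s; _≟_)
open import Data.Nat.Properties
open import Data.Nat.ListAction using (sum)
open import Algebra.Properties.CommutativeSemigroup +-commutativeSemigroup using (x∙yz≈y∙xz; xy∙z≈zy∙x; xy∙z≈xz∙y; x∙yz≈yx∙z)
open import Data.Bool using (Bool; true; false; not; _∧_; _∨_; if_then_else_; T; T?)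
open import Data.Bool.Properties using (T-≡; T-∧; T-∨; ∧-zeroʳ; ∧-identityʳ; ∨-zeroʳ; ∨-identityʳ; not-involutive)
import Data.Bool.Properties as Bool
open import Data.Bool.ListAction using (any; all)
open import Data.Fin using (Fin; zero)
open import Data.Vec as V using (Vec; []; _∷_)
open import Data.Vec.Properties using (lookup-map; lookup-replicate) renaming (≡-dec to ≡-decᵥ)
open import Data.List using (List; []; _∷_; [_]; length; map; _++_; filter; filterᵇ; upTo; concatMap; deduplicate)
open import Data.List.NonEmpty using (List⁺; _∷_; toList)
open import Data.List.Properties using (≡-dec; length-map; map-++; map-∘; map-cong)
open import Data.List.Relation.Unary.Any as Any using (here; there; index; any?)
open import Data.List.Relation.Unary.Any.Properties using (any⁺; any⁻)
open import Data.List.Relation.Unary.All as All using (All; []; _∷_; all?)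
import Data.List.Relation.Unary.All.Properties as All
open import Data.List.Relation.Unary.All.Properties using (all⁺; all⁻)
import Data.List.Relation.Unary.AllPairs as AllPairs
import Data.List.Relation.Unary.AllPairs.Properties as AllPairs
import Data.List.Relation.Unary.Linked as Linked
import Data.List.Relation.Unary.Linked.Properties as Linked
open import Data.List.Relation.Unary.Linked.Properties using (Linked⇒AllPairs; AllPairs⇒Linked)
open import Data.List.Relation.Unary.Unique.Propositional using (Unique; []; _∷_)
import Data.List.Relation.Unary.Unique.Propositional.Properties as Unique
open import Data.List.Relation.Unary.Unique.DecPropositional.Properties _≟_ using (deduplicate-!)
open import Data.List.Relation.Binary.Permutation.Propositional using (_↭_; refl; prep; swap; trans)
open import Data.List.Relation.Binary.BagAndSetEquality using (∼bag⇒↭)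
open import Data.List.Relation.Binary.Subset.Propositional.Properties using (Any-resp-⊆)
open import Data.List.Membership.Propositional using (_∈_; _∉_; find; lose)
open import Data.List.Membership.Propositional.Properties
  using (∈-filter⁺; ∈-filter⁻; ∈-map⁺; ∈-map⁻; ∈-upTo⁺; ∈-concatMap⁺; ∈-concatMap⁻; ∈-deduplicate⁺; ∈-deduplicate⁻)
open import Data.List.Membership.Propositional.Properties.WithK using (unique∧set⇒bag)
import Data.List.Membership.DecPropositional as DecMembership
open DecMembership _≟_ using (_∈?_)
open import Data.Product using (∃-syntax; _×_; _,_; proj₁; proj₂)
open import Data.Sum using (_⊎_; inj₁; inj₂)
open import Data.Empty using (⊥; ⊥-elim)
open import Function using (_∘_; const)
open import Function.Bundles using (_⇔_; mk⇔; Equivalence)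
open import Relation.Nullary using (¬_; Dec; yes; no; does)
open import Relation.Nullary.Decidable using (dec-true; dec-false)
open import Relation.Binary.Definitions using (DecidableEquality)
open import Relation.Binary.Bundles using (Setoid)
import Relation.Binary.Reasoning.Setoid as SetoidReasoning
open import Relation.Binary.PropositionalEquality using (_≡_; _≢_; refl; sym; cong; cong₂; subst; module ≡-Reasoning)
  renaming (trans to ≡-trans)

private variable
  A B : Set

bit : Bool → ℕ
bit true  = 1
bit false = 0

count : (A → Bool) → List A → ℕ
count p []       = 0
count p (x ∷ xs) = bit (p x) + count p xs

count-cong : ∀ {p q : A → Bool} xs → (∀ x → x ∈ xs → p x ≡ q x) → count p xs ≡ count q xs
count-cong []       p≗q = refl
count-cong (x ∷ xs) p≗q = cong₂ _+_ (cong bit (p≗q x (here refl))) (count-cong xs (λ y y∈ → p≗q y (there y∈)))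

count-map : ∀ (p : B → Bool) (f : A → B) xs → count p (map f xs) ≡ count (p ∘ f) xs
count-map p f []       = refl
count-map p f (x ∷ xs) = cong (bit (p (f x)) +_) (count-map p f xs)

count-++ : ∀ (p : A → Bool) xs ys → count p (xs ++ ys) ≡ count p xs + count p ys
count-++ p []       ys = refl
count-++ p (x ∷ xs) ys = ≡-trans (cong (bit (p x) +_) (count-++ p xs ys)) (sym (+-assoc (bit (p x)) _ _))

count-filter : ∀ (q p : A → Bool) xs → count q (filterᵇ p xs) ≡ count (λ x → p x ∧ q x) xs
count-filter q p []       = refl
count-filter q p (x ∷ xs) with p x
... | true  = cong (bit (q x) +_) (count-filter q p xs)
... | false = count-filter q p xs

count-split : ∀ (q p : A → Bool) xs →
  count p xs ≡ count (λ x → q x ∧ p x) xs + count (λ x → not (q x) ∧ p x) xs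
count-split q p []       = refl
count-split q p (x ∷ xs) with q x
... | true  = ≡-trans (cong (bit (p x) +_) (count-split q p xs)) (sym (+-assoc (bit (p x)) _ _))
... | false = ≡-trans (cong (bit (p x) +_) (count-split q p xs)) (x∙yz≈y∙xz (bit (p x)) (count (λ y → q y ∧ p y) xs) _)

count-complement : ∀ (p : A → Bool) xs → count p xs + count (not ∘ p) xs ≡ length xs
count-complement p []       = refl
count-complement p (x ∷ xs) with p x
... | true  = cong suc (count-complement p xs)
... | false = ≡-trans (+-suc _ _) (cong suc (count-complement p xs))

count-all : ∀ {p : A → Bool} xs → (∀ x → x ∈ xs → p x ≡ true) → count p xs ≡ length xs
count-all {p = p} xs all-p = ≡-trans (count-cong xs all-p) (count-true xs)
  where
  count-true : ∀ xs → count (const true) xs ≡ length xs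
  count-true []       = refl
  count-true (x ∷ xs) = cong suc (count-true xs)

count-none : ∀ {p : A → Bool} xs → (∀ x → x ∈ xs → p x ≡ false) → count p xs ≡ 0
count-none {p = p} xs no-p = ≡-trans (count-cong xs no-p) (count-false xs)
  where
  count-false : ∀ xs → count (const false) xs ≡ 0
  count-false []       = refl
  count-false (x ∷ xs) = count-false xs

length-filter : ∀ (p : A → Bool) xs → length (filterᵇ p xs) ≡ count p xs
length-filter p xs = ≡-trans (sym (count-all (filterᵇ p xs) (λ _ _ → refl)))
                             (≡-trans (count-filter (const true) p xs) (count-cong xs (λ x _ → ∧-identityʳ (p x))))

count-positive : ∀ {p : A → Bool} {x xs} → x ∈ xs → p x ≡ true → 0 < count p xs
count-positive {p = p} {xs = _ ∷ xs} (here refl) px = subst (λ b → 0 < bit b + count p xs) (sym px) (s≤s z≤n)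
count-positive {p = p} (there {x = y} x∈) px = ≤-trans (count-positive x∈ px) (m≤n+m _ (bit (p y)))

count-witness : ∀ (p : A → Bool) xs → 0 < count p xs → ∃[ x ] (x ∈ xs × p x ≡ true)
count-witness p (x ∷ xs) pos with p x in px
... | true  = x , here refl , px
... | false = let y , y∈ , py = count-witness p xs pos in y , there y∈ , py

-- Equality of lists as multisets: every predicate is satisfied equally often.
-- (A record, so that the two lists can be inferred from a proof.)

infix 4 _≈_
record _≈_ (X Y : List A) : Set where
  constructor same-counts
  field count-≡ : ∀ p → count p X ≡ count p Y
open _≈_

≡⇒≈ : {X Y : List A} → X ≡ Y → X ≈ Y
≡⇒≈ refl = same-counts λ _ → refl

≈-refl : {X : List A} → X ≈ X
≈-refl = same-counts λ _ → refl

≈-sym : {X Y : List A} → X ≈ Y → Y ≈ X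
≈-sym X≈Y = same-counts λ p → sym (count-≡ X≈Y p)

≈-trans : {X Y Z : List A} → X ≈ Y → Y ≈ Z → X ≈ Z
≈-trans X≈Y Y≈Z = same-counts λ p → ≡-trans (count-≡ X≈Y p) (count-≡ Y≈Z p)

≈-map : ∀ (f : A → B) {X Y} → X ≈ Y → map f X ≈ map f Y
≈-map f {X} {Y} X≈Y = same-counts λ p →
  ≡-trans (count-map p f X) (≡-trans (count-≡ X≈Y (p ∘ f)) (sym (count-map p f Y)))

≈-setoid : Set → Setoid _ _
≈-setoid A = record
  { Carrier = List A ; _≈_ = _≈_
  ; isEquivalence = record { refl = ≈-refl ; sym = ≈-sym ; trans = ≈-trans } }

map-cong-≈ : ∀ {f g : A → B} X → (∀ x → x ∈ X → f x ≡ g x) → map f X ≈ map g X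
map-cong-≈ {f = f} {g} X f≗g = same-counts λ p →
  ≡-trans (count-map p f X) (≡-trans (count-cong X λ x x∈ → cong p (f≗g x x∈)) (sym (count-map p g X)))

≈-++ : {X X′ Y Y′ : List A} → X ≈ X′ → Y ≈ Y′ → X ++ Y ≈ X′ ++ Y′
≈-++ {X = X} {X′} {Y} {Y′} X≈X′ Y≈Y′ = same-counts λ p →
  ≡-trans (count-++ p X Y) (≡-trans (cong₂ _+_ (count-≡ X≈X′ p) (count-≡ Y≈Y′ p)) (sym (count-++ p X′ Y′)))

↭⇒≈ : {X Y : List A} → X ↭ Y → X ≈ Y
↭⇒≈ X↭Y = same-counts (counts X↭Y)
  where
  counts : ∀ {X Y} → X ↭ Y → ∀ p → count p X ≡ count p Y
  counts refl               p = refl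
  counts (prep x X↭Y)       p = cong (bit (p x) +_) (counts X↭Y p)
  counts (swap x y X↭Y)     p = ≡-trans (x∙yz≈y∙xz (bit (p x)) (bit (p y)) _) (cong (λ n → bit (p y) + (bit (p x) + n)) (counts X↭Y p))
  counts (trans X↭Y Y↭Z)    p = ≡-trans (counts X↭Y p) (counts Y↭Z p)

T-does : ∀ {X : Set} (x? : Dec X) → T (does x?) ⇔ X
T-does (yes x) = mk⇔ (const x) (const _)
T-does (no ¬x) = mk⇔ (λ ()) ¬x

does-true : ∀ {X : Set} (x? : Dec X) → does x? ≡ true → X
does-true (yes x) _ = x

does-false : ∀ {X : Set} (x? : Dec X) → does x? ≡ false → ¬ X
does-false (no ¬x) _ = ¬x

_∈ᵇ_ : ℕ → List ℕ → Bool
x ∈ᵇ xs = does (x ∈? xs)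

∈ᵇ-T : ∀ {x xs} → T (x ∈ᵇ xs) ⇔ x ∈ xs
∈ᵇ-T {x} {xs} = T-does (x ∈? xs)

∈ᵇ⇒∈ : ∀ {x xs} → x ∈ᵇ xs ≡ true → x ∈ xs
∈ᵇ⇒∈ {x} {xs} = does-true (x ∈? xs)

T-ext : ∀ {a b} → (T a → T b) → (T b → T a) → a ≡ b
T-ext {false} {false} _   _   = refl
T-ext {false} {true}  _   b⇒a = ⊥-elim (b⇒a _)
T-ext {true}  {false} a⇒b _   = ⊥-elim (a⇒b _)
T-ext {true}  {true}  _   _   = refl

∈-filterᵇ⁻ : ∀ {p : A → Bool} {x} xs → x ∈ filterᵇ p xs → x ∈ xs × p x ≡ true
∈-filterᵇ⁻ {p = p} xs x∈ = let x∈xs , px = ∈-filter⁻ (T? ∘ p) {xs = xs} x∈ in x∈xs , Equivalence.to T-≡ px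

∈-filterᵇ⁺ : ∀ {p : A → Bool} {x xs} → x ∈ xs → p x ≡ true → x ∈ filterᵇ p xs
∈-filterᵇ⁺ {p = p} x∈xs px = ∈-filter⁺ (T? ∘ p) x∈xs (Equivalence.from T-≡ px)

same-members⇒≈ : {X Y : List A} → Unique X → Unique Y → (∀ {x} → x ∈ X ⇔ x ∈ Y) → X ≈ Y
same-members⇒≈ X! Y! X⇔Y = ↭⇒≈ (∼bag⇒↭ (unique∧set⇒bag X! Y! X⇔Y))

filter-members : ∀ {L D : List ℕ} → Unique L → Unique D → (∀ {x} → x ∈ D → x ∈ L) →
  filterᵇ (_∈ᵇ D) L ≈ D
filter-members {L} {D} L! D! D⊆L =
  same-members⇒≈ (Unique.filter⁺ (T? ∘ (_∈ᵇ D)) L!) D! (mk⇔ to from)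
  where
  to : ∀ {x} → x ∈ filterᵇ (_∈ᵇ D) L → x ∈ D
  to x∈ = ∈ᵇ⇒∈ (proj₂ (∈-filterᵇ⁻ L x∈))
  from : ∀ {x} → x ∈ D → x ∈ filterᵇ (_∈ᵇ D) L
  from {x} x∈D = ∈-filterᵇ⁺ (D⊆L x∈D) (dec-true (x ∈? D) x∈D)

length-as-count : ∀ {L D : List ℕ} → Unique L → Unique D → (∀ {x} → x ∈ D → x ∈ L) →
  length D ≡ count (_∈ᵇ D) L
length-as-count {L} {D} L! D! D⊆L = begin
  length D                            ≡⟨ sym (count-all D (λ _ _ → refl)) ⟩
  count (const true) D                ≡⟨ sym (count-≡ (filter-members L! D! D⊆L) (const true)) ⟩
  count (const true) (filterᵇ (_∈ᵇ D) L) ≡⟨ count-all (filterᵇ (_∈ᵇ D) L) (λ _ _ → refl) ⟩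
  length (filterᵇ (_∈ᵇ D) L)          ≡⟨ length-filter (_∈ᵇ D) L ⟩
  count (_∈ᵇ D) L                     ∎
  where open ≡-Reasoning

map-unique : ∀ {f : A → B} {L} → Unique L → (∀ {x y} → x ∈ L → y ∈ L → f x ≡ f y → x ≡ y) → Unique (map f L)
map-unique {L = []}    []          inj = []
map-unique {L = x ∷ L} (x∉ ∷ L!)  inj =
  All.map⁺ (All.tabulate (λ y∈ fx≡fy → All.lookup x∉ y∈ (inj (here refl) (there y∈) fx≡fy)))
  ∷ map-unique L! (λ x∈ y∈ → inj (there x∈) (there y∈))

involution-≈ : ∀ {σ : ℕ → ℕ} {L} → Unique L → (∀ {x} → x ∈ L → σ x ∈ L) →
  (∀ {x} → x ∈ L → σ (σ x) ≡ x) → map σ L ≈ L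
involution-≈ {σ} {L} L! σ∈ σσ = same-members⇒≈ (map-unique L! σ-inj) L! (mk⇔ to from)
  where
  σ-inj : ∀ {x y} → x ∈ L → y ∈ L → σ x ≡ σ y → x ≡ y
  σ-inj x∈ y∈ eq = ≡-trans (sym (σσ x∈)) (≡-trans (cong σ eq) (σσ y∈))
  to : ∀ {x} → x ∈ map σ L → x ∈ L
  to x∈ with ∈-map⁻ σ x∈
  ... | y , y∈ , refl = σ∈ y∈
  from : ∀ {x} → x ∈ L → x ∈ map σ L
  from x∈ = subst (_∈ map σ L) (σσ x∈) (∈-map⁺ σ (σ∈ x∈))

agree-off : ∀ {L D : List ℕ} (f g : ℕ → Bool) → Unique L → Unique D → (∀ {x} → x ∈ D → x ∈ L) →
  (∀ {x} → x ∈ L → x ∉ D → f x ≡ g x) → count f L + count g D ≡ count g L + count f D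
agree-off {L} {D} f g L! D! D⊆L agree = begin
  count f L + count g D               ≡⟨ cong (_+ count g D) (split f) ⟩
  (count f D + off f) + count g D     ≡⟨ cong (λ n → (count f D + n) + count g D) off-agree ⟩
  (count f D + off g) + count g D     ≡⟨ xy∙z≈zy∙x (count f D) (off g) (count g D) ⟩
  (count g D + off g) + count f D     ≡⟨ cong (_+ count f D) (sym (split g)) ⟩
  count g L + count f D               ∎
  where
  open ≡-Reasoning
  off : (ℕ → Bool) → ℕ
  off h = count (λ x → not (x ∈ᵇ D) ∧ h x) L
  split : ∀ h → count h L ≡ count h D + off h
  split h = ≡-trans (count-split (_∈ᵇ D) h L)
    (cong (_+ off h) (≡-trans (sym (count-filter h (_∈ᵇ D) L)) (count-≡ (filter-members L! D! D⊆L) h)))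
  off-agree : off f ≡ off g
  off-agree = count-cong L λ x x∈ → outside x x∈ (x ∈? D)
    where
    outside : ∀ x → x ∈ L → (x∈D? : Dec (x ∈ D)) → not (does x∈D?) ∧ f x ≡ not (does x∈D?) ∧ g x
    outside x x∈ (yes _)  = refl
    outside x x∈ (no x∉D) = agree x∈ x∉D

agree-off-point : ∀ {L x} (f g : ℕ → Bool) → Unique L → x ∈ L → (∀ {e} → e ∈ L → e ≢ x → f e ≡ g e) →
  count f L + bit (g x) ≡ count g L + bit (f x)
agree-off-point {L} {x} f g L! x∈L agree = begin
  count f L + bit (g x)        ≡⟨ cong (count f L +_) (sym (+-identityʳ _)) ⟩
  count f L + count g [ x ]    ≡⟨ agree-off f g L! ([] ∷ []) (λ { (here refl) → x∈L }) (λ e∈ e∉ → agree e∈ (e∉ ∘ here)) ⟩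
  count g L + count f [ x ]    ≡⟨ cong (count g L +_) (+-identityʳ _) ⟩
  count g L + bit (f x)        ∎
  where open ≡-Reasoning

agree-off-≈ : ∀ {L D : List ℕ} (f g : ℕ → A) → Unique L → Unique D → (∀ {x} → x ∈ D → x ∈ L) →
  (∀ {x} → x ∈ L → x ∉ D → f x ≡ g x) → map f L ++ map g D ≈ map g L ++ map f D
agree-off-≈ {L = L} {D} f g L! D! D⊆L agree = same-counts λ p → let open ≡-Reasoning in begin
  count p (map f L ++ map g D)          ≡⟨ images p f g ⟩
  count (p ∘ f) L + count (p ∘ g) D     ≡⟨ agree-off (p ∘ f) (p ∘ g) L! D! D⊆L (λ x∈ x∉ → cong p (agree x∈ x∉)) ⟩
  count (p ∘ g) L + count (p ∘ f) D     ≡⟨ sym (images p g f) ⟩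
  count p (map g L ++ map f D)          ∎
  where
  images : ∀ p h k → count p (map h L ++ map k D) ≡ count (p ∘ h) L + count (p ∘ k) D
  images p h k = ≡-trans (count-++ p (map h L) (map k D)) (cong₂ _+_ (count-map p h L) (count-map p k D))

-- Boolean vectors, read as subsets of {0, …, n-1}.

_≟ᵥ_ : ∀ {n} → DecidableEquality (Vec Bool n)
_≟ᵥ_ = ≡-decᵥ Bool._≟_

complement : ∀ {n} → Vec Bool n → Vec Bool n
complement = V.map not

_⊆ᵇ_ : ∀ {n} → Vec Bool n → Vec Bool n → Bool
[]          ⊆ᵇ []      = true
(true ∷ w)  ⊆ᵇ (b ∷ u) = b ∧ (w ⊆ᵇ u)
(false ∷ w) ⊆ᵇ (b ∷ u) = w ⊆ᵇ u

meets : ∀ {n} → Vec Bool n → Vec Bool n → Bool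
meets []      []      = false
meets (a ∷ w) (b ∷ u) = (a ∧ b) ∨ meets w u

nonzero : ∀ {n} → Vec Bool n → Bool
nonzero []      = false
nonzero (b ∷ w) = b ∨ nonzero w

isFull : ∀ {n} → Vec Bool n → Bool
isFull []      = true
isFull (b ∷ w) = b ∧ isFull w

full : ∀ {n} → Vec Bool n
full {n} = V.replicate n true

complement-involutive : ∀ {n} (u : Vec Bool n) → complement (complement u) ≡ u
complement-involutive []      = refl
complement-involutive (b ∷ u) = cong₂ _∷_ (not-involutive b) (complement-involutive u)

meets-⊆ᵇ-complement : ∀ {n} (w u : Vec Bool n) → meets w u ≡ not (w ⊆ᵇ complement u)
meets-⊆ᵇ-complement []          []          = refl
meets-⊆ᵇ-complement (true ∷ w)  (true ∷ u)  = refl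
meets-⊆ᵇ-complement (true ∷ w)  (false ∷ u) = meets-⊆ᵇ-complement w u
meets-⊆ᵇ-complement (false ∷ w) (b ∷ u)     = meets-⊆ᵇ-complement w u

full-⊆ᵇ : ∀ {n} (u : Vec Bool n) → full ⊆ᵇ u ≡ isFull u
full-⊆ᵇ []      = refl
full-⊆ᵇ (b ∷ u) = cong (b ∧_) (full-⊆ᵇ u)

⊆ᵇ-full : ∀ {n} (w u : Vec Bool n) → isFull u ≡ true → w ⊆ᵇ u ≡ true
⊆ᵇ-full []          []         _      = refl
⊆ᵇ-full (true ∷ w)  (true ∷ u) u-full = ⊆ᵇ-full w u u-full
⊆ᵇ-full (false ∷ w) (true ∷ u) u-full = ⊆ᵇ-full w u u-full

zero-⊆ᵇ : ∀ {n} (w u : Vec Bool n) → nonzero w ≡ false → w ⊆ᵇ u ≡ true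
zero-⊆ᵇ []          []      _      = refl
zero-⊆ᵇ (false ∷ w) (b ∷ u) w-zero = zero-⊆ᵇ w u w-zero

isFull⇒full : ∀ {n} (u : Vec Bool n) → isFull u ≡ true → u ≡ full
isFull⇒full []         _      = refl
isFull⇒full (true ∷ u) u-full = cong (true ∷_) (isFull⇒full u u-full)

lookup-complement : ∀ {n} (i : Fin n) u → V.lookup (complement u) i ≡ not (V.lookup u i)
lookup-complement i u = lookup-map i not u

⊆ᵇ-complement-full : ∀ {n} (w u : Vec Bool n) → nonzero w ≡ true → isFull u ≡ true →
  w ⊆ᵇ complement u ≡ false
⊆ᵇ-complement-full (true ∷ w)  (true ∷ u) _       _      = refl
⊆ᵇ-complement-full (false ∷ w) (true ∷ u) w-nz    u-full = ⊆ᵇ-complement-full w u w-nz u-full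

-- Möbius inversion on the Boolean lattice: a multiset of Boolean vectors is
-- determined by how many of its members contain each vector w.

tails : ∀ {n} → Bool → List (Vec Bool (suc n)) → List (Vec Bool n)
tails b       []                  = []
tails true    ((true ∷ u) ∷ X)    = u ∷ tails true X
tails true    ((false ∷ u) ∷ X)   = tails true X
tails false   ((true ∷ u) ∷ X)    = tails false X
tails false   ((false ∷ u) ∷ X)   = u ∷ tails false X

count-by-head : ∀ {n} (p : Vec Bool (suc n) → Bool) X →
  count p X ≡ count (p ∘ (true ∷_)) (tails true X) + count (p ∘ (false ∷_)) (tails false X)
count-by-head p []                = refl
count-by-head p ((true ∷ u) ∷ X)  =
  ≡-trans (cong (bit (p (true ∷ u)) +_) (count-by-head p X)) (sym (+-assoc (bit (p (true ∷ u))) _ _))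
count-by-head p ((false ∷ u) ∷ X) =
  ≡-trans (cong (bit (p (false ∷ u)) +_) (count-by-head p X))
          (x∙yz≈y∙xz (bit (p (false ∷ u))) (count (p ∘ (true ∷_)) (tails true X)) _)

upset-counts-determine : ∀ {n} (X Y : List (Vec Bool n)) →
  (∀ w → count (w ⊆ᵇ_) X ≡ count (w ⊆ᵇ_) Y) → X ≈ Y
upset-counts-determine X Y same = same-counts (determined X Y same)
  where
  determined : ∀ {n} (X Y : List (Vec Bool n)) →
    (∀ w → count (w ⊆ᵇ_) X ≡ count (w ⊆ᵇ_) Y) → ∀ p → count p X ≡ count p Y
  determined {zero} X Y same p with p [] in p[]
  ... | true  = begin
    count p X          ≡⟨ count-cong X (λ { [] _ → p[] }) ⟩
    count ([] ⊆ᵇ_) X   ≡⟨ same [] ⟩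
    count ([] ⊆ᵇ_) Y   ≡⟨ sym (count-cong Y (λ { [] _ → p[] })) ⟩
    count p Y          ∎
    where open ≡-Reasoning
  ... | false = ≡-trans (count-none X (λ { [] _ → p[] })) (sym (count-none Y (λ { [] _ → p[] })))
  determined {suc n} X Y same p = begin
    count p X ≡⟨ count-by-head p X ⟩
    count (p ∘ (true ∷_)) (tails true X) + count (p ∘ (false ∷_)) (tails false X)
      ≡⟨ cong₂ _+_ (determined (tails true X) (tails true Y) same-true (p ∘ (true ∷_)))
                   (determined (tails false X) (tails false Y) same-false (p ∘ (false ∷_))) ⟩
    count (p ∘ (true ∷_)) (tails true Y) + count (p ∘ (false ∷_)) (tails false Y) ≡⟨ sym (count-by-head p Y) ⟩
    count p Y ∎
    where
    open ≡-Reasoning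
    -- (true ∷ w) sees only the vectors with first coordinate true
    via-true : ∀ Z w → count ((true ∷ w) ⊆ᵇ_) Z ≡ count (w ⊆ᵇ_) (tails true Z)
    via-true Z w = ≡-trans (count-by-head ((true ∷ w) ⊆ᵇ_) Z)
                     (≡-trans (cong (count (w ⊆ᵇ_) (tails true Z) +_) (count-none (tails false Z) (λ _ _ → refl))) (+-identityʳ _))
    same-true : ∀ w → count (w ⊆ᵇ_) (tails true X) ≡ count (w ⊆ᵇ_) (tails true Y)
    same-true w = ≡-trans (sym (via-true X w)) (≡-trans (same (true ∷ w)) (via-true Y w))
    -- (false ∷ w) sees both halves
    same-false : ∀ w → count (w ⊆ᵇ_) (tails false X) ≡ count (w ⊆ᵇ_) (tails false Y)
    same-false w = +-cancelˡ-≡ (count (w ⊆ᵇ_) (tails true X)) _ _ (begin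
      count (w ⊆ᵇ_) (tails true X) + count (w ⊆ᵇ_) (tails false X) ≡⟨ sym (count-by-head ((false ∷ w) ⊆ᵇ_) X) ⟩
      count ((false ∷ w) ⊆ᵇ_) X ≡⟨ same (false ∷ w) ⟩
      count ((false ∷ w) ⊆ᵇ_) Y ≡⟨ count-by-head ((false ∷ w) ⊆ᵇ_) Y ⟩
      count (w ⊆ᵇ_) (tails true Y) + count (w ⊆ᵇ_) (tails false Y)
        ≡⟨ cong (_+ count (w ⊆ᵇ_) (tails false Y)) (sym (same-true w)) ⟩
      count (w ⊆ᵇ_) (tails true X) + count (w ⊆ᵇ_) (tails false Y) ∎)

_∈ₛᵇ_ : ℕ → FinSet → Bool
x ∈ₛᵇ S = x ∈ᵇ proj₁ S

elements-unique : (S : FinSet) → Unique (proj₁ S)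
elements-unique (_ , sorted) = AllPairs.map (λ x<y → <⇒≢ x<y) (Linked⇒AllPairs <-trans sorted)

-- finite sets have decidable equality, the sortedness proofs being irrelevant
_≟ₛ_ : DecidableEquality FinSet
(xs , xs-sorted) ≟ₛ (ys , ys-sorted) with ≡-dec _≟_ xs ys
... | no  xs≢ys = no (xs≢ys ∘ cong proj₁)
... | yes refl  = yes (cong (xs ,_) (Linked.irrelevant <-irrelevant xs-sorted ys-sorted))

open DecMembership _≟ₛ_ using () renaming (_∈?_ to _∈ᶜ?_)

-- The finite set {x < B | q x}.
-- (opaque: only its membership properties below are ever needed)
opaque
  setOf : (ℕ → Bool) → ℕ → FinSet
  setOf q B = filterᵇ q (upTo B) ,
    Linked.filter⁺ (T? ∘ q) <-trans (AllPairs⇒Linked (AllPairs.applyUpTo⁺₁ (λ x → x) B (λ x<y _ → x<y)))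

  setOf-∈ᵇ : ∀ q B {x} → x < B → x ∈ₛᵇ setOf q B ≡ q x
  setOf-∈ᵇ q B {x} x<B with q x in qx
  ... | true  = dec-true (x ∈? proj₁ (setOf q B)) (∈-filterᵇ⁺ (∈-upTo⁺ x<B) qx)
  ... | false = dec-false (x ∈? proj₁ (setOf q B)) (λ x∈ → case-false (proj₂ (∈-filterᵇ⁻ (upTo B) x∈)))
    where
    case-false : q x ≡ true → ⊥
    case-false qx≡true with () ← ≡-trans (sym qx) qx≡true

  setOf-⊆ : ∀ q B {x} → x ∈ₛ setOf q B → q x ≡ true
  setOf-⊆ q B x∈ = proj₂ (∈-filterᵇ⁻ (upTo B) x∈)

-- The finite set obtained from S by removing r and adding a (points below B only).
exchange : FinSet → (r a B : ℕ) → FinSet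
exchange S r a = setOf (λ e → (e ∈ₛᵇ S ∧ not (does (e ≟ r))) ∨ does (e ≟ a))

exchange-other : ∀ S {r a B e} → e < B → e ≢ r → e ≢ a → e ∈ₛᵇ exchange S r a B ≡ e ∈ₛᵇ S
exchange-other S {r} {a} {B} {e} e<B e≢r e≢a = begin
  e ∈ₛᵇ exchange S r a B                               ≡⟨ setOf-∈ᵇ _ B e<B ⟩
  (e ∈ₛᵇ S ∧ not (does (e ≟ r))) ∨ does (e ≟ a)
    ≡⟨ cong₂ (λ b c → (e ∈ₛᵇ S ∧ not b) ∨ c) (dec-false (e ≟ r) e≢r) (dec-false (e ≟ a) e≢a) ⟩
  (e ∈ₛᵇ S ∧ true) ∨ false                              ≡⟨ ≡-trans (∨-identityʳ _) (∧-identityʳ _) ⟩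
  e ∈ₛᵇ S                                               ∎
  where open ≡-Reasoning

exchange-removed : ∀ S {r a B} → r < B → r ≢ a → r ∈ₛᵇ exchange S r a B ≡ false
exchange-removed S {r} {a} {B} r<B r≢a = ≡-trans (setOf-∈ᵇ _ B r<B)
  (≡-trans (cong₂ (λ b c → (r ∈ₛᵇ S ∧ not b) ∨ c) (dec-true (r ≟ r) refl) (dec-false (r ≟ a) r≢a))
           (≡-trans (∨-identityʳ _) (∧-zeroʳ _)))

exchange-added : ∀ S {r a B} → a < B → a ∈ₛᵇ exchange S r a B ≡ true
exchange-added S {r} {a} {B} a<B = ≡-trans (setOf-∈ᵇ _ B a<B)
  (≡-trans (cong ((a ∈ₛᵇ S ∧ not (does (a ≟ r))) ∨_) (dec-true (a ≟ a) refl)) (∨-zeroʳ _))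

exchange-⊆ : ∀ S {r a B e} → e ∈ₛ exchange S r a B → e ∈ₛ S ⊎ e ≡ a
exchange-⊆ S {r} {a} {B} {e} e∈ with Equivalence.to T-∨ (Equivalence.from T-≡ (setOf-⊆ _ B e∈))
... | inj₁ kept  = inj₁ (Equivalence.to ∈ᵇ-T (proj₁ (Equivalence.to T-∧ kept)))
... | inj₂ added = inj₂ (Equivalence.to (T-does (e ≟ a)) added)

-- Every member of L is below bound L; in particular bound L is a point outside L.
bound : List ℕ → ℕ
bound L = suc (sum L)

<-bound : ∀ {x} L → x ∈ L → x < bound L
<-bound (y ∷ L) (here refl) = s≤s (m≤m+n y (sum L))
<-bound (y ∷ L) (there x∈) = ≤-trans (<-bound L x∈) (s≤s (m≤n+m (sum L) y))

any-members : ∀ (p : A → Bool) {xs ys} → (∀ {x} → x ∈ xs → x ∈ ys) → (∀ {x} → x ∈ ys → x ∈ xs) →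
  any p xs ≡ any p ys
any-members p {xs} {ys} xs⊆ys ys⊆xs =
  T-ext (any⁺ p ∘ Any-resp-⊆ xs⊆ys ∘ any⁻ p xs) (any⁺ p ∘ Any-resp-⊆ ys⊆xs ∘ any⁻ p ys)

all-members : ∀ (p : A → Bool) {xs ys} → (∀ {x} → x ∈ xs → x ∈ ys) → (∀ {x} → x ∈ ys → x ∈ xs) →
  all p xs ≡ all p ys
all-members p {xs} {ys} xs⊆ys ys⊆xs =
  T-ext (all⁻ p ∘ All.anti-mono ys⊆xs ∘ all⁺ p xs) (all⁻ p ∘ All.anti-mono xs⊆ys ∘ all⁺ p ys)

record Enumerates (F : Collection) (L : List ℕ) : Set where
  field
    unique   : Unique L
    sound    : ∀ {e} → e ∈ L → e ∈⋃ F
    complete : ∀ {e} → e ∈⋃ F → e ∈ L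

ground : Collection → List ℕ
ground F = deduplicate _≟_ (concatMap proj₁ (toList F))

∈-ground⁻ : ∀ F {x} → x ∈ ground F → x ∈⋃ F
∈-ground⁻ F x∈ = find (∈-concatMap⁻ proj₁ {xs = toList F} (∈-deduplicate⁻ _≟_ _ x∈))

∈-ground⁺ : ∀ F {x} → x ∈⋃ F → x ∈ ground F
∈-ground⁺ F (S , S∈F , x∈S) = ∈-deduplicate⁺ _≟_ (∈-concatMap⁺ proj₁ {xs = toList F} (lose S∈F x∈S))

ground-enumerates : ∀ F → Enumerates F (ground F)
ground-enumerates F = record { unique = deduplicate-! _ ; sound = ∈-ground⁻ F ; complete = ∈-ground⁺ F }

unionSize-count : ∀ (Γ : Collection) {L} → Unique L → (∀ {x S} → S ∈ᶜ Γ → x ∈ₛ S → x ∈ L) →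
  unionSize Γ ≡ count (λ x → any (x ∈ₛᵇ_) (toList Γ)) L
unionSize-count Γ {L} L! ⋃Γ⊆L =
  ≡-trans (length-as-count L! (deduplicate-! _) ground⊆L) (count-cong L λ x _ → T-ext (to x) (from x))
  where
  ground⊆L : ∀ {x} → x ∈ ground Γ → x ∈ L
  ground⊆L x∈ = let S , S∈ , x∈S = ∈-ground⁻ Γ x∈ in ⋃Γ⊆L S∈ x∈S
  to : ∀ x → T (x ∈ᵇ ground Γ) → T (any (x ∈ₛᵇ_) (toList Γ))
  to x x∈ = let S , S∈ , x∈S = ∈-ground⁻ Γ (Equivalence.to ∈ᵇ-T x∈) in
    any⁺ (x ∈ₛᵇ_) (lose S∈ (Equivalence.from ∈ᵇ-T x∈S))
  from : ∀ x → T (any (x ∈ₛᵇ_) (toList Γ)) → T (x ∈ᵇ ground Γ)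
  from x x∈ = let S , S∈ , x∈S = find (any⁻ (x ∈ₛᵇ_) (toList Γ) x∈) in
    Equivalence.from ∈ᵇ-T (∈-ground⁺ Γ (S , S∈ , Equivalence.to ∈ᵇ-T x∈S))

interSize-count : ∀ (Γ : Collection) {L} → Unique L → (∀ {x S} → S ∈ᶜ Γ → x ∈ₛ S → x ∈ L) →
  interSize Γ ≡ count (λ x → all (x ∈ₛᵇ_) (toList Γ)) L
interSize-count (S ∷ Δ) {L} L! ⋃Γ⊆L =
  ≡-trans (length-as-count L! (Unique.filter⁺ in-Δ? (elements-unique S)) ⋂⊆L) (count-cong L λ x _ → T-ext (to x) (from x))
  where
  in-Δ? = λ x → all? (λ R → x ∈? proj₁ R) Δ
  ⋂ = filter in-Δ? (proj₁ S)
  ⋂⊆L : ∀ {x} → x ∈ ⋂ → x ∈ L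
  ⋂⊆L x∈ = ⋃Γ⊆L (here refl) (proj₁ (∈-filter⁻ in-Δ? {xs = proj₁ S} x∈))
  to : ∀ x → T (x ∈ᵇ ⋂) → T (all (x ∈ₛᵇ_) (S ∷ Δ))
  to x x∈ = let x∈S , x∈Δ = ∈-filter⁻ in-Δ? {xs = proj₁ S} (Equivalence.to ∈ᵇ-T x∈) in
    all⁻ (x ∈ₛᵇ_) {xs = S ∷ Δ} (All.map (Equivalence.from ∈ᵇ-T) (x∈S ∷ x∈Δ))
  from : ∀ x → T (all (x ∈ₛᵇ_) (S ∷ Δ)) → T (x ∈ᵇ ⋂)
  from x x∈ with x∈S ∷ x∈Δ ← All.map (Equivalence.to ∈ᵇ-T) (all⁺ (x ∈ₛᵇ_) (S ∷ Δ) x∈) =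
    Equivalence.from ∈ᵇ-T (∈-filter⁺ in-Δ? x∈S x∈Δ)

patternOf : (ps : List FinSet) → ℕ → Vec Bool (length ps)
patternOf []       e = []
patternOf (S ∷ ps) e = (e ∈ₛᵇ S) ∷ patternOf ps e

patternOf-lookup : ∀ {ps S} (S∈ : S ∈ ps) e → V.lookup (patternOf ps e) (index S∈) ≡ e ∈ₛᵇ S
patternOf-lookup (here refl) e = refl
patternOf-lookup (there S∈)  e = patternOf-lookup S∈ e

patternOf-outside : ∀ ps e → (∀ {S} → S ∈ ps → e ∈ₛᵇ S ≡ false) → patternOf ps e ≡ complement full
patternOf-outside []       e outside = refl
patternOf-outside (S ∷ ps) e outside = cong₂ _∷_ (outside (here refl)) (patternOf-outside ps e (outside ∘ there))

select : (ps : List FinSet) → Vec Bool (length ps) → List FinSet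
select []       []          = []
select (S ∷ ps) (true ∷ w)  = S ∷ select ps w
select (S ∷ ps) (false ∷ w) = select ps w

select-⊆ : ∀ ps w {S} → S ∈ select ps w → S ∈ ps
select-⊆ []       []          ()
select-⊆ (R ∷ ps) (true ∷ w)  (here refl) = here refl
select-⊆ (R ∷ ps) (true ∷ w)  (there S∈)  = there (select-⊆ ps w S∈)
select-⊆ (R ∷ ps) (false ∷ w) S∈          = there (select-⊆ ps w S∈)

select-full : ∀ ps → select ps full ≡ ps
select-full []       = refl
select-full (S ∷ ps) = cong (S ∷_) (select-full ps)

∈-select⇒nonzero : ∀ ps w {S} → S ∈ select ps w → nonzero w ≡ true
∈-select⇒nonzero []       []          ()
∈-select⇒nonzero (R ∷ ps) (true ∷ w)  _  = refl
∈-select⇒nonzero (R ∷ ps) (false ∷ w) S∈ = ∈-select⇒nonzero ps w S∈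

nonzero⇒select : ∀ ps w → nonzero w ≡ true → ∃[ S ] ∃[ rest ] (select ps w ≡ S ∷ rest)
nonzero⇒select []       []          ()
nonzero⇒select (S ∷ ps) (true ∷ w)  _  = S , select ps w , refl
nonzero⇒select (S ∷ ps) (false ∷ w) nz = nonzero⇒select ps w nz

select-any : ∀ ps w e → any (e ∈ₛᵇ_) (select ps w) ≡ meets w (patternOf ps e)
select-any []       []          e = refl
select-any (S ∷ ps) (true ∷ w)  e = cong ((e ∈ₛᵇ S) ∨_) (select-any ps w e)
select-any (S ∷ ps) (false ∷ w) e = select-any ps w e

select-all : ∀ ps w e → all (e ∈ₛᵇ_) (select ps w) ≡ w ⊆ᵇ patternOf ps e
select-all []       []          e = refl
select-all (S ∷ ps) (true ∷ w)  e = cong ((e ∈ₛᵇ S) ∧_) (select-all ps w e)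
select-all (S ∷ ps) (false ∷ w) e = select-all ps w e

maskOf : (ps Γ : List FinSet) → Vec Bool (length ps)
maskOf []       Γ = []
maskOf (S ∷ ps) Γ = does (S ∈ᶜ? Γ) ∷ maskOf ps Γ

select-mask⁻ : ∀ ps Γ {S} → S ∈ select ps (maskOf ps Γ) → S ∈ Γ
select-mask⁻ (R ∷ ps) Γ S∈ with R ∈ᶜ? Γ | S∈
... | yes R∈Γ | here refl = R∈Γ
... | yes _   | there S∈′ = select-mask⁻ ps Γ S∈′
... | no _    | S∈′       = select-mask⁻ ps Γ S∈′

select-mask⁺ : ∀ ps Γ {S} → S ∈ ps → S ∈ Γ → S ∈ select ps (maskOf ps Γ)
select-mask⁺ (R ∷ ps) Γ S∈ps S∈Γ with R ∈ᶜ? Γ | S∈ps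
... | yes _   | here refl = here refl
... | no R∉Γ  | here refl = ⊥-elim (R∉Γ S∈Γ)
... | yes _   | there S∈  = there (select-mask⁺ ps Γ S∈ S∈Γ)
... | no _    | there S∈  = select-mask⁺ ps Γ S∈ S∈Γ

module Criterion (F : Collection) {L : List ℕ} (enum : Enumerates F L) where
  open Enumerates enum

  ps : List FinSet
  ps = toList F

  P : ℕ → Vec Bool (length ps)
  P = patternOf ps

  -- |⋃Γ| + |⋂Γ| for the subcollection Γ selected by w
  value : Vec Bool (length ps) → ℕ
  value w = count (meets w ∘ P) L + count ((w ⊆ᵇ_) ∘ P) L

  fullCount : ℕ
  fullCount = count (isFull ∘ P) L

  profile : List (Vec Bool (length ps))
  profile = filterᵇ (not ∘ isFull) (map P L)

  Balanced : Set
  Balanced = profile ≈ map complement profile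

  value-of : ∀ (Γ : Collection) w → (∀ {S} → S ∈ᶜ Γ → S ∈ select ps w) → (∀ {S} → S ∈ select ps w → S ∈ᶜ Γ) →
    unionSize Γ + interSize Γ ≡ value w
  value-of Γ w Γ⊆ ⊆Γ = cong₂ _+_
    (≡-trans (unionSize-count Γ unique ⋃Γ⊆L) (count-cong L λ e _ → ≡-trans (any-members (e ∈ₛᵇ_) Γ⊆ ⊆Γ) (select-any ps w e)))
    (≡-trans (interSize-count Γ unique ⋃Γ⊆L) (count-cong L λ e _ → ≡-trans (all-members (e ∈ₛᵇ_) Γ⊆ ⊆Γ) (select-all ps w e)))
    where
    ⋃Γ⊆L : ∀ {x S} → S ∈ᶜ Γ → x ∈ₛ S → x ∈ L
    ⋃Γ⊆L S∈ x∈S = complete (_ , select-⊆ ps w (Γ⊆ S∈) , x∈S)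

  hke⇒value : ∀ {α} → IsHKE F α → ∀ w → nonzero w ≡ true → value w ≡ 2 * α
  hke⇒value (_ , hke) w nz with nonzero⇒select ps w nz
  ... | S , rest , selected = ≡-trans (sym (value-of Γ w Γ⊆ ⊆Γ)) (hke Γ (All.tabulate (select-⊆ ps w ∘ Γ⊆)))
    where
    Γ : Collection
    Γ = S ∷ rest
    Γ⊆ : ∀ {R} → R ∈ᶜ Γ → R ∈ select ps w
    Γ⊆ R∈ = subst (_ ∈_) (sym selected) R∈
    ⊆Γ : ∀ {R} → R ∈ select ps w → R ∈ᶜ Γ
    ⊆Γ R∈ = subst (_ ∈_) selected R∈

  value⇒hke : ∀ {α} → 0 < α → (∀ w → nonzero w ≡ true → value w ≡ 2 * α) → IsHKE F α
  value⇒hke {α} α>0 value≡ = α>0 , hke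
    where
    hke : ∀ Γ → Γ ⊆ᶜ F → unionSize Γ + interSize Γ ≡ 2 * α
    hke Γ Γ⊆F = ≡-trans (value-of Γ w Γ⊆ (select-mask⁻ ps (toList Γ))) (value≡ w (∈-select⇒nonzero ps w (Γ⊆ (here refl))))
      where
      w = maskOf ps (toList Γ)
      Γ⊆ : ∀ {S} → S ∈ᶜ Γ → S ∈ select ps w
      Γ⊆ S∈ = select-mask⁺ ps (toList Γ) (All.lookup Γ⊆F S∈) S∈

  count-profile : ∀ q → count q profile ≡ count (λ e → not (isFull (P e)) ∧ q (P e)) L
  count-profile q = ≡-trans (count-filter q (not ∘ isFull) (map P L)) (count-map _ P L)

  count-complement-profile : ∀ q → count q (map complement profile) ≡ count (λ e → not (isFull (P e)) ∧ q (complement (P e))) L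
  count-complement-profile q = ≡-trans (count-map q complement profile) (count-profile (q ∘ complement))

  union-complement : ∀ w → count (meets w ∘ P) L + count (λ e → w ⊆ᵇ complement (P e)) L ≡ length L
  union-complement w = ≡-trans (cong (_+ count q L) (count-cong L λ e _ → meets-⊆ᵇ-complement w (P e)))
                               (≡-trans (+-comm (count (not ∘ q) L) (count q L)) (count-complement q L))
    where q = λ e → w ⊆ᵇ complement (P e)

  inter-profile : ∀ w → count ((w ⊆ᵇ_) ∘ P) L ≡ fullCount + count (w ⊆ᵇ_) profile
  inter-profile w = ≡-trans (count-split (isFull ∘ P) ((w ⊆ᵇ_) ∘ P) L)
    (cong₂ _+_ (count-cong L λ e _ → full-part e (isFull (P e)) refl) (sym (count-profile (w ⊆ᵇ_))))
    where
    full-part : ∀ e b → isFull (P e) ≡ b → b ∧ (w ⊆ᵇ P e) ≡ b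
    full-part e true  full = ⊆ᵇ-full w (P e) full
    full-part e false _    = refl

  -- Full points contribute nothing to the complemented counts.
  complement-profile : ∀ w → nonzero w ≡ true →
    count (λ e → w ⊆ᵇ complement (P e)) L ≡ count (w ⊆ᵇ_) (map complement profile)
  complement-profile w nz = ≡-trans (count-split (isFull ∘ P) (λ e → w ⊆ᵇ complement (P e)) L)
    (≡-trans (cong (_+ count (λ e → not (isFull (P e)) ∧ (w ⊆ᵇ complement (P e))) L)
                   (count-none L λ e _ → full-part e (isFull (P e)) refl))
             (sym (count-complement-profile (w ⊆ᵇ_))))
    where
    full-part : ∀ e b → isFull (P e) ≡ b → b ∧ (w ⊆ᵇ complement (P e)) ≡ false
    full-part e true  full = ⊆ᵇ-complement-full w (P e) nz full
    full-part e false _    = refl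

  balance-identity : ∀ w → nonzero w ≡ true →
    value w + count (w ⊆ᵇ_) (map complement profile) ≡ (fullCount + length L) + count (w ⊆ᵇ_) profile
  balance-identity w nz = begin
    (m + i) + count (w ⊆ᵇ_) (map complement profile) ≡⟨ cong ((m + i) +_) (sym (complement-profile w nz)) ⟩
    (m + i) + c                                       ≡⟨ xy∙z≈xz∙y m i c ⟩
    (m + c) + i                                       ≡⟨ cong₂ _+_ (union-complement w) (inter-profile w) ⟩
    length L + (fullCount + count (w ⊆ᵇ_) profile)    ≡⟨ x∙yz≈yx∙z (length L) fullCount _ ⟩
    (fullCount + length L) + count (w ⊆ᵇ_) profile    ∎
    where
    open ≡-Reasoning
    m = count (meets w ∘ P) L
    i = count ((w ⊆ᵇ_) ∘ P) L
    c = count (λ e → w ⊆ᵇ complement (P e)) L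

  -- Every point lies in some set, so no pattern is empty.
  full-meets : ∀ {e} → e ∈ L → meets full (P e) ≡ true
  full-meets {e} e∈L = let S , S∈F , e∈S = sound e∈L in
    ≡-trans (sym (≡-trans (cong (any (e ∈ₛᵇ_)) (sym (select-full ps))) (select-any ps full e)))
            (Equivalence.to T-≡ (any⁺ (e ∈ₛᵇ_) (lose S∈F (Equivalence.from ∈ᵇ-T e∈S))))

  full-value : value full ≡ fullCount + length L
  full-value = +-cancelʳ-≡ 0 (value full) (fullCount + length L) (begin
    value full + 0 ≡⟨ cong (value full +_) (sym no-empty) ⟩
    value full + count (full ⊆ᵇ_) (map complement profile) ≡⟨ balance-identity full refl ⟩
    (fullCount + length L) + count (full ⊆ᵇ_) profile ≡⟨ cong ((fullCount + length L) +_) no-full ⟩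
    (fullCount + length L) + 0 ∎)
    where
    open ≡-Reasoning
    no-full : count (full ⊆ᵇ_) profile ≡ 0
    no-full = ≡-trans (count-profile (full ⊆ᵇ_)) (count-none L λ e _ → full-part (full-⊆ᵇ (P e)))
      where
      full-part : ∀ {b c} → b ≡ c → not c ∧ b ≡ false
      full-part {false} refl = refl
      full-part {true}  refl = refl
    no-empty : count (full ⊆ᵇ_) (map complement profile) ≡ 0
    no-empty = ≡-trans (sym (complement-profile full refl)) (+-cancelˡ-≡ (length L) _ 0 (begin
      length L + count (λ e → full ⊆ᵇ complement (P e)) L
        ≡⟨ cong (_+ count (λ e → full ⊆ᵇ complement (P e)) L) (sym (count-all {p = meets full ∘ P} L λ _ e∈ → full-meets e∈)) ⟩
      count (meets full ∘ P) L + count (λ e → full ⊆ᵇ complement (P e)) L ≡⟨ union-complement full ⟩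
      length L ≡⟨ sym (+-identityʳ _) ⟩
      length L + 0 ∎))

  -- hke ⇒ criterion: the size equation comes from w = full; for other nonzero w the
  -- identity shows that the profile and its complement have the same upset counts,
  -- which determine a multiset.
  criterion⇒ : ∀ {α} → IsHKE F α → Balanced × fullCount + length L ≡ 2 * α
  criterion⇒ {α} hke = balanced , size
    where
    open ≡-Reasoning
    size : fullCount + length L ≡ 2 * α
    size = ≡-trans (sym full-value) (hke⇒value hke full refl)
    balanced : Balanced
    balanced = upset-counts-determine profile (map complement profile) λ w → upsets w (nonzero w) refl
      where
      upsets : ∀ w b → nonzero w ≡ b → count (w ⊆ᵇ_) profile ≡ count (w ⊆ᵇ_) (map complement profile)
      upsets w true nz = +-cancelˡ-≡ (2 * α) _ _ (begin
        2 * α + count (w ⊆ᵇ_) profile                  ≡⟨ cong (_+ count (w ⊆ᵇ_) profile) (sym size) ⟩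
        (fullCount + length L) + count (w ⊆ᵇ_) profile ≡⟨ sym (balance-identity w nz) ⟩
        value w + count (w ⊆ᵇ_) (map complement profile) ≡⟨ cong (_+ count (w ⊆ᵇ_) (map complement profile)) (hke⇒value hke w nz) ⟩
        2 * α + count (w ⊆ᵇ_) (map complement profile) ∎)
      upsets w false z = begin
        count (w ⊆ᵇ_) profile                     ≡⟨ count-all profile (λ u _ → zero-⊆ᵇ w u z) ⟩
        length profile                            ≡⟨ sym (length-map complement profile) ⟩
        length (map complement profile)           ≡⟨ sym (count-all (map complement profile) (λ u _ → zero-⊆ᵇ w u z)) ⟩
        count (w ⊆ᵇ_) (map complement profile)    ∎

  criterion⇐ : ∀ {α} → 0 < α → Balanced → fullCount + length L ≡ 2 * α → IsHKE F α
  criterion⇐ {α} α>0 balanced size = value⇒hke α>0 λ w nz → +-cancelʳ-≡ (count (w ⊆ᵇ_) (map complement profile)) _ _ (begin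
    value w + count (w ⊆ᵇ_) (map complement profile) ≡⟨ balance-identity w nz ⟩
    (fullCount + length L) + count (w ⊆ᵇ_) profile   ≡⟨ cong₂ _+_ size (count-≡ balanced (w ⊆ᵇ_)) ⟩
    2 * α + count (w ⊆ᵇ_) (map complement profile)   ∎)
    where open ≡-Reasoning

  module _ (no-full : ∀ {e} → e ∈ L → isFull (P e) ≡ false) where

    fullCount-zero : fullCount ≡ 0
    fullCount-zero = count-none L λ _ → no-full

    profile-all : profile ≈ map P L
    profile-all = same-counts λ q → ≡-trans (count-profile q)
      (≡-trans (count-cong L λ e e∈ → cong (λ b → not b ∧ q (P e)) (no-full e∈)) (sym (count-map q P L)))

SelfComplementary : ∀ {n} → List (Vec Bool n) → Set
SelfComplementary X = X ≈ map complement X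

sc-resp : ∀ {n} {X Y : List (Vec Bool n)} → X ≈ Y → SelfComplementary X → SelfComplementary Y
sc-resp X≈Y sc-X = ≈-trans (≈-sym X≈Y) (≈-trans sc-X (≈-map complement X≈Y))

sc-pair : ∀ {n} (u : Vec Bool n) → SelfComplementary (u ∷ complement u ∷ [])
sc-pair u = same-counts λ p → ≡-trans (x∙yz≈y∙xz (bit (p u)) (bit (p (complement u))) 0)
                      (cong (λ v → bit (p (complement u)) + (bit (p v) + 0)) (sym (complement-involutive u)))

sc-++ : ∀ {n} {X Y : List (Vec Bool n)} → SelfComplementary X → SelfComplementary Y → SelfComplementary (X ++ Y)
sc-++ {X = X} {Y} sc-X sc-Y = ≈-trans (≈-++ sc-X sc-Y) (≡⇒≈ (sym (map-++ complement X Y)))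

sc-cancel : ∀ {n} {X A Y : List (Vec Bool n)} → X ++ A ≈ Y →
  SelfComplementary A → SelfComplementary Y → SelfComplementary X
sc-cancel {X = X} {A} {Y} X+A≈Y sc-A sc-Y = same-counts λ p → +-cancelʳ-≡ (count p A) _ _ (let open ≡-Reasoning in begin
  count p X + count p A                              ≡⟨ sym (count-++ p X A) ⟩
  count p (X ++ A)                                   ≡⟨ count-≡ (≈-trans X+A≈Y sc-Y) p ⟩
  count p (map complement Y)                         ≡⟨ count-≡ (≈-map complement (≈-sym X+A≈Y)) p ⟩
  count p (map complement (X ++ A))                  ≡⟨ cong (count p) (map-++ complement X A) ⟩
  count p (map complement X ++ map complement A)     ≡⟨ count-++ p (map complement X) (map complement A) ⟩
  count p (map complement X) + count p (map complement A) ≡⟨ cong (count p (map complement X) +_) (sym (count-≡ sc-A p)) ⟩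
  count p (map complement X) + count p A             ∎)

-- The pattern of a point after a copy of the i-th set is added in front.
copy : ∀ {n} → Fin n → Vec Bool n → Vec Bool (suc n)
copy i u = V.lookup u i ∷ u

complement-copy : ∀ {n} (i : Fin n) u → complement (copy i u) ≡ copy i (complement u)
complement-copy i u = cong (_∷ complement u) (sym (lookup-complement i u))

isFull-copy : ∀ {n} (i : Fin n) u → isFull (copy i u) ≡ isFull u
isFull-copy i u with isFull u in u-full
... | true  = ≡-trans (∧-identityʳ _) (≡-trans (cong (λ v → V.lookup v i) (isFull⇒full u u-full)) (lookup-replicate i true))
... | false = ∧-zeroʳ _

sc-map-copy : ∀ {n} (i : Fin n) {X} → SelfComplementary X → SelfComplementary (map (copy i) X)
sc-map-copy i {X} sc-X = ≈-trans (≈-map (copy i) sc-X) (≡⇒≈ (begin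
  map (copy i) (map complement X)   ≡⟨ sym (map-∘ X) ⟩
  map (copy i ∘ complement) X       ≡⟨ map-cong (λ u → sym (complement-copy i u)) X ⟩
  map (complement ∘ copy i) X       ≡⟨ map-∘ X ⟩
  map complement (map (copy i) X)   ∎))
  where open ≡-Reasoning

_⊕_ : FinSet → Collection → Collection
T ⊕ F = T ∷ toList F

not-extendable : ∀ {F T α} → Maximal F → T ∉ toList F → ¬ IsHKE (T ⊕ F) α
not-extendable {F} {T} {α} (_ , no-extension) T∉F hke =
  no-extension (T ⊕ F , (α , hke) , All.tabulate there , T , here refl , T∉F)

extend-enumeration : ∀ {F L T} → Enumerates F L → (∀ {e} → e ∈ₛ T → e ∈ L) → Enumerates (T ⊕ F) L
extend-enumeration {F} {L} {T} enum T⊆L = record { unique = unique ; sound = sound′ ; complete = complete′ }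
  where
  open Enumerates enum
  sound′ : ∀ {e} → e ∈ L → e ∈⋃ (T ⊕ F)
  sound′ e∈ = let S , S∈ , e∈S = sound e∈ in S , there S∈ , e∈S
  complete′ : ∀ {e} → e ∈⋃ (T ⊕ F) → e ∈ L
  complete′ (S , here refl , e∈T) = T⊆L e∈T
  complete′ (S , there S∈ , e∈S) = complete (S , S∈ , e∈S)

module MaximalStructure {F : Collection} {α : ℕ} (maximal : Maximal F) (hke : IsHKE F α) where

  L : List ℕ
  L = ground F

  enum : Enumerates F L
  enum = ground-enumerates F

  open Enumerates enum
  open Criterion F enum

  balanced : Balanced
  balanced = proj₁ (criterion⇒ hke)

  size : fullCount + length L ≡ 2 * α
  size = proj₂ (criterion⇒ hke)

  bound∉L : bound L ∉ L
  bound∉L z∈ = <-irrefl refl (<-bound L z∈)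

  -- If x lay in every set, replacing x by a fresh point z in the first set S₀
  -- would give a new set S′ such that S′ ⊕ F is still hke.
  module RemoveFullPoint {x} (x∈L : x ∈ L) (x-full : isFull (P x) ≡ true) where
    S₀ = List⁺.head F
    z  = bound L
    S′ = exchange S₀ x z (suc z)

    <suc-z : ∀ {e} → e ∈ L → e < suc z
    <suc-z e∈ = m<n⇒m<1+n (<-bound L e∈)

    ≢z : ∀ {e} → e ∈ L → e ≢ z
    ≢z e∈ refl = bound∉L e∈

    enum′ : Enumerates (S′ ⊕ F) (z ∷ L)
    enum′ = record { unique = All.tabulate (λ e∈ z≡e → ≢z e∈ (sym z≡e)) ∷ unique ; sound = sound′ ; complete = complete′ }
      where
      sound′ : ∀ {e} → e ∈ z ∷ L → e ∈⋃ (S′ ⊕ F)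
      sound′ (here refl) = S′ , here refl , ∈ᵇ⇒∈ (exchange-added S₀ ≤-refl)
      sound′ (there e∈)  = let S , S∈ , e∈S = sound e∈ in S , there S∈ , e∈S
      complete′ : ∀ {e} → e ∈⋃ (S′ ⊕ F) → e ∈ z ∷ L
      complete′ (S , here refl , e∈S′) with exchange-⊆ S₀ e∈S′
      ... | inj₁ e∈S₀ = there (complete (S₀ , here refl , e∈S₀))
      ... | inj₂ refl = here refl
      complete′ (S , there S∈ , e∈S) = there (complete (S , S∈ , e∈S))

    module C′ = Criterion (S′ ⊕ F) enum′

    S′∉F : S′ ∉ toList F
    S′∉F S′∈F = bound∉L (complete (S′ , S′∈F , ∈ᵇ⇒∈ (exchange-added S₀ ≤-refl)))

    -- the new patterns: z lies only in S′, x has left S′, other points see S′ as S₀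
    pattern-z : C′.P z ≡ true ∷ complement full
    pattern-z = cong₂ _∷_ (exchange-added S₀ ≤-refl)
      (patternOf-outside (toList F) z λ S∈ → dec-false (z ∈? _) λ z∈S → bound∉L (complete (_ , S∈ , z∈S)))

    pattern-x : C′.P x ≡ false ∷ full
    pattern-x = cong₂ _∷_ (exchange-removed S₀ (<suc-z x∈L) (≢z x∈L)) (isFull⇒full (P x) x-full)

    pattern-other : ∀ {e} → e ∈ L → e ≢ x → C′.P e ≡ copy zero (P e)
    pattern-other e∈ e≢x = cong (_∷ _) (exchange-other S₀ (<suc-z e∈) e≢x (≢z e∈))

    -- The new profile consists of the old one with S₀ copied in front, plus the
    -- complementary pair t = pattern of z and complement t = pattern of x.
    t : Vec Bool (suc (length (toList F)))
    t = true ∷ complement full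

    copied : List (Vec Bool (suc (length (toList F))))
    copied = map (copy zero) profile

    new old : (Vec Bool (suc (length (toList F))) → Bool) → ℕ → Bool
    new q e = not (isFull (C′.P e)) ∧ q (C′.P e)
    old q e = not (isFull (P e)) ∧ q (copy zero (P e))

    -- on L the new and copied patterns differ only at x
    count-on-L : ∀ q → count (new q) L ≡ count q copied + bit (q (false ∷ full))
    count-on-L q = +-cancelʳ-≡ 0 _ _ (begin
      count (new q) L + 0               ≡⟨ cong (λ b → count (new q) L + bit (not b ∧ q (copy zero (P x)))) (sym x-full) ⟩
      count (new q) L + bit (old q x)   ≡⟨ agree-off-point (new q) (old q) unique x∈L new≡old ⟩
      count (old q) L + bit (new q x)   ≡⟨ cong₂ _+_ (≡-trans (sym (count-profile (q ∘ copy zero))) (sym (count-map q (copy zero) profile)))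
                                                     (cong (λ u → bit (not (isFull u) ∧ q u)) pattern-x) ⟩
      count q copied + bit (q (false ∷ full))       ≡⟨ sym (+-identityʳ _) ⟩
      count q copied + bit (q (false ∷ full)) + 0   ∎)
      where
      open ≡-Reasoning
      new≡old : ∀ {e} → e ∈ L → e ≢ x → new q e ≡ old q e
      new≡old {e} e∈ e≢x = ≡-trans (cong (λ u → not (isFull u) ∧ q u) (pattern-other e∈ e≢x))
                                   (cong (λ b → not b ∧ q (copy zero (P e))) (isFull-copy zero (P e)))

    profile′ : C′.profile ≈ (t ∷ complement t ∷ []) ++ copied
    profile′ = same-counts λ q → begin
      count q C′.profile                                      ≡⟨ C′.count-profile q ⟩
      bit (new q z) + count (new q) L                         ≡⟨ cong₂ _+_ (cong (λ u → bit (not (isFull u) ∧ q u)) pattern-z) (count-on-L q) ⟩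
      bit (q t) + (count q copied + bit (q (false ∷ full)))   ≡⟨ cong (bit (q t) +_) (+-comm (count q copied) _) ⟩
      bit (q t) + (bit (q (false ∷ full)) + count q copied)
        ≡⟨ cong (λ u → bit (q t) + (bit (q (false ∷ u)) + count q copied)) (sym (complement-involutive full)) ⟩
      count q ((t ∷ complement t ∷ []) ++ copied)             ∎
      where open ≡-Reasoning

    balanced′ : C′.Balanced
    balanced′ = sc-resp (≈-sym profile′) (sc-++ (sc-pair t) (sc-map-copy zero balanced))

    -- x no longer lies in every set, while z is a new point.
    size′ : C′.fullCount + length (z ∷ L) ≡ 2 * α
    size′ = begin
      C′.fullCount + suc (length L)              ≡⟨ +-suc C′.fullCount (length L) ⟩
      suc (C′.fullCount + length L)              ≡⟨ cong (λ u → suc (bit (isFull u) + count (isFull ∘ C′.P) L + length L)) pattern-z ⟩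
      suc (count (isFull ∘ C′.P) L) + length L   ≡⟨ cong (_+ length L) lost-one ⟩
      fullCount + length L                       ≡⟨ size ⟩
      2 * α                                      ∎
      where
      open ≡-Reasoning
      lost-one : suc (count (isFull ∘ C′.P) L) ≡ fullCount
      lost-one = begin
        suc (count (isFull ∘ C′.P) L)              ≡⟨ +-comm 1 _ ⟩
        count (isFull ∘ C′.P) L + bit true         ≡⟨ cong (λ b → count (isFull ∘ C′.P) L + bit b) (sym x-full) ⟩
        count (isFull ∘ C′.P) L + bit (isFull (P x))
          ≡⟨ agree-off-point (isFull ∘ C′.P) (isFull ∘ P) unique x∈L
               (λ {e} e∈ e≢x → ≡-trans (cong isFull (pattern-other e∈ e≢x)) (isFull-copy zero (P e))) ⟩
        fullCount + bit (isFull (C′.P x))          ≡⟨ cong (λ u → fullCount + bit (isFull u)) pattern-x ⟩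
        fullCount + 0                              ≡⟨ +-identityʳ _ ⟩
        fullCount                                  ∎

    extension-hke : IsHKE (S′ ⊕ F) α
    extension-hke = C′.criterion⇐ (proj₁ hke) balanced′ size′

  no-full-point : ∀ {x} → x ∈ L → isFull (P x) ≡ false
  no-full-point {x} x∈L with isFull (P x) in x-full
  ... | false = refl
  ... | true  = ⊥-elim (not-extendable maximal S′∉F extension-hke)
    where open RemoveFullPoint x∈L x-full

  patterns-sc : SelfComplementary (map P L)
  patterns-sc = sc-resp (profile-all no-full-point) balanced

  extend-inside : ∀ S′ → (∀ {e} → e ∈ₛ S′ → e ∈ L) → SelfComplementary (map (patternOf (S′ ∷ toList F)) L) →
    IsHKE (S′ ⊕ F) α
  extend-inside S′ S′⊆L sc = C′.criterion⇐ (proj₁ hke) (sc-resp (≈-sym (C′.profile-all no-full′)) sc) size′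
    where
    module C′ = Criterion (S′ ⊕ F) (extend-enumeration enum S′⊆L)
    no-full′ : ∀ {e} → e ∈ L → isFull (C′.P e) ≡ false
    no-full′ {e} e∈ = ≡-trans (cong ((e ∈ₛᵇ S′) ∧_) (no-full-point e∈)) (∧-zeroʳ _)
    size′ : C′.fullCount + length L ≡ 2 * α
    size′ = ≡-trans (cong (_+ length L) (≡-trans (C′.fullCount-zero no-full′) (sym (fullCount-zero no-full-point)))) size

  partner : ∀ {x} → x ∈ L → ∃[ y ] (y ∈ L × P y ≡ complement (P x))
  partner {x} x∈L =
    let u , u∈ , u-c    = count-witness is-c (map P L) positive
        y , y∈ , u≡Py   = ∈-map⁻ P u∈
    in y , y∈ , ≡-trans (sym u≡Py) (does-true (u ≟ᵥ complement (P x)) u-c)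
    where
    is-c : Vec Bool (length (toList F)) → Bool
    is-c u = does (u ≟ᵥ complement (P x))
    positive : 0 < count is-c (map P L)
    positive = subst (0 <_) (sym (count-≡ patterns-sc is-c))
      (count-positive (∈-map⁺ complement (∈-map⁺ P x∈L)) (dec-true (complement (P x) ≟ᵥ complement (P x)) refl))

  -- If distinct points x and y shared the pattern w, take S ∋ x and a point y′
  -- of pattern complement w; exchanging y for y′ in S would give a new set S′
  -- such that S′ ⊕ F is still hke.
  module ExchangeTwins {x y y′ S} (x∈L : x ∈ L) (y∈L : y ∈ L) (Px≡Py : P x ≡ P y) (x≢y : x ≢ y)
                       (y′∈L : y′ ∈ L) (Py′ : P y′ ≡ complement (P x)) (S∈F : S ∈ᶜ F) (x∈S : x ∈ₛ S) where
    w = P x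
    i = index S∈F

    in-S : ∀ e → V.lookup (P e) i ≡ e ∈ₛᵇ S
    in-S = patternOf-lookup S∈F

    x∈ᵇS : x ∈ₛᵇ S ≡ true
    x∈ᵇS = dec-true (x ∈? proj₁ S) x∈S

    w-i : V.lookup w i ≡ true
    w-i = ≡-trans (in-S x) x∈ᵇS

    y∈S : y ∈ₛᵇ S ≡ true
    y∈S = ≡-trans (sym (in-S y)) (≡-trans (cong (λ u → V.lookup u i) (sym Px≡Py)) w-i)

    y′∉S : y′ ∈ₛᵇ S ≡ false
    y′∉S = ≡-trans (sym (in-S y′))
             (≡-trans (cong (λ u → V.lookup u i) Py′) (≡-trans (lookup-complement i w) (cong not w-i)))

    ≢y′ : ∀ {e} → e ∈ₛᵇ S ≡ true → e ≢ y′
    ≢y′ e∈S refl with () ← ≡-trans (sym e∈S) y′∉S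

    S′ = exchange S y y′ (bound L)

    S′⊆L : ∀ {e} → e ∈ₛ S′ → e ∈ L
    S′⊆L e∈ with exchange-⊆ S e∈
    ... | inj₁ e∈S = complete (S , S∈F , e∈S)
    ... | inj₂ refl = y′∈L

    -- S′ would separate x from y, which have the same pattern
    separates : S′ ∈ toList F → true ≡ false
    separates S′∈F = begin
      true                                 ≡⟨ sym x∈ᵇS ⟩
      x ∈ₛᵇ S                              ≡⟨ sym (exchange-other S (<-bound L x∈L) x≢y (≢y′ x∈ᵇS)) ⟩
      x ∈ₛᵇ S′                             ≡⟨ sym (patternOf-lookup S′∈F x) ⟩
      V.lookup (P x) (index S′∈F)          ≡⟨ cong (λ u → V.lookup u (index S′∈F)) Px≡Py ⟩
      V.lookup (P y) (index S′∈F)          ≡⟨ patternOf-lookup S′∈F y ⟩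
      y ∈ₛᵇ S′                             ≡⟨ exchange-removed S (<-bound L y∈L) (≢y′ y∈S) ⟩
      false                                ∎
      where open ≡-Reasoning

    S′∉F : S′ ∉ toList F
    S′∉F S′∈F with () ← separates S′∈F

    P′ = patternOf (S′ ∷ toList F)

    agree : ∀ {e} → e ∈ L → e ∉ y ∷ y′ ∷ [] → P′ e ≡ copy i (P e)
    agree {e} e∈ e∉ =
      cong (_∷ P e) (≡-trans (exchange-other S (<-bound L e∈) (e∉ ∘ here) (e∉ ∘ there ∘ here)) (sym (in-S e)))

    -- On {y, y′} the copied patterns are {true ∷ w, false ∷ complement w}, the new
    -- ones {false ∷ w, true ∷ complement w}: complementary pairs in both cases.
    old-values : map (copy i ∘ P) (y ∷ y′ ∷ []) ≡ (true ∷ w) ∷ complement (true ∷ w) ∷ []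
    old-values = cong₂ (λ u v → u ∷ v ∷ [])
      (≡-trans (cong (copy i) (sym Px≡Py)) (cong (_∷ w) w-i))
      (≡-trans (cong (copy i) Py′) (cong (_∷ complement w) (≡-trans (lookup-complement i w) (cong not w-i))))

    new-values : map P′ (y ∷ y′ ∷ []) ≡ (false ∷ w) ∷ complement (false ∷ w) ∷ []
    new-values = cong₂ (λ u v → u ∷ v ∷ [])
      (cong₂ _∷_ (exchange-removed S (<-bound L y∈L) (≢y′ y∈S)) (sym Px≡Py))
      (cong₂ _∷_ (exchange-added S (<-bound L y′∈L)) Py′)

    sc′ : SelfComplementary (map P′ L)
    sc′ = sc-cancel (agree-off-≈ P′ (copy i ∘ P) unique ((≢y′ y∈S ∷ []) ∷ [] ∷ []) y-y′⊆L agree)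
      (sc-resp (≡⇒≈ (sym old-values)) (sc-pair (true ∷ w)))
      (sc-++ (sc-resp (≡⇒≈ (sym (map-∘ L))) (sc-map-copy i patterns-sc))
             (sc-resp (≡⇒≈ (sym new-values)) (sc-pair (false ∷ w))))
      where
      y-y′⊆L : ∀ {e} → e ∈ y ∷ y′ ∷ [] → e ∈ L
      y-y′⊆L (here refl)         = y∈L
      y-y′⊆L (there (here refl)) = y′∈L

    extension-hke : IsHKE (S′ ⊕ F) α
    extension-hke = extend-inside S′ S′⊆L sc′

  patterns-injective : ∀ {x y} → x ∈ L → y ∈ L → P x ≡ P y → x ≡ y
  patterns-injective {x} {y} x∈L y∈L Px≡Py with x ≟ y
  ... | yes x≡y = x≡y
  ... | no  x≢y =
    let y′ , y′∈L , Py′ = partner x∈L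
        S  , S∈F  , x∈S = sound x∈L
        open ExchangeTwins x∈L y∈L Px≡Py x≢y y′∈L Py′ S∈F x∈S
    in ⊥-elim (not-extendable maximal S′∉F extension-hke)

  σ : ℕ → ℕ
  σ e with any? (λ d → P d ≟ᵥ complement (P e)) L
  ... | yes found = proj₁ (find found)
  ... | no  _     = e

  σ-spec : ∀ {e} → e ∈ L → σ e ∈ L × P (σ e) ≡ complement (P e)
  σ-spec {e} e∈ with any? (λ d → P d ≟ᵥ complement (P e)) L
  ... | yes found = proj₂ (find found)
  ... | no  none  = let d , d∈ , Pd = partner e∈ in ⊥-elim (none (lose d∈ Pd))

  σ-∈ : ∀ {e} → e ∈ L → σ e ∈ L
  σ-∈ = proj₁ ∘ σ-spec

  -- σ is an involution because patterns determine points

  σ-involutive : ∀ {e} → e ∈ L → σ (σ e) ≡ e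
  σ-involutive {e} e∈ = patterns-injective (σ-∈ (σ-∈ e∈)) e∈ (begin
    P (σ (σ e))                  ≡⟨ proj₂ (σ-spec (σ-∈ e∈)) ⟩
    complement (P (σ e))         ≡⟨ cong complement (proj₂ (σ-spec e∈)) ⟩
    complement (complement (P e)) ≡⟨ complement-involutive (P e) ⟩
    P e                          ∎)
    where open ≡-Reasoning

  flips : ∀ {S e} → S ∈ᶜ F → e ∈ L → σ e ∈ₛᵇ S ≡ not (e ∈ₛᵇ S)
  flips {S} {e} S∈F e∈ = begin
    σ e ∈ₛᵇ S                                  ≡⟨ sym (patternOf-lookup S∈F (σ e)) ⟩
    V.lookup (P (σ e)) (index S∈F)             ≡⟨ cong (λ u → V.lookup u (index S∈F)) (proj₂ (σ-spec e∈)) ⟩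
    V.lookup (complement (P e)) (index S∈F)    ≡⟨ lookup-complement (index S∈F) (P e) ⟩
    not (V.lookup (P e) (index S∈F))           ≡⟨ cong not (patternOf-lookup S∈F e) ⟩
    not (e ∈ₛᵇ S)                              ∎
    where open ≡-Reasoning

  -- Conversely, every such transversal of σ is a member of F: adding it
  -- would keep the patterns self-complementary.
  transversal-∈ : ∀ S′ → (∀ {e} → e ∈ₛ S′ → e ∈ L) →
    (∀ {e} → e ∈ L → σ e ∈ₛᵇ S′ ≡ not (e ∈ₛᵇ S′)) → S′ ∈ᶜ F
  transversal-∈ S′ S′⊆L flips′ with S′ ∈ᶜ? toList F
  ... | yes S′∈F = S′∈F
  ... | no  S′∉F = ⊥-elim (not-extendable maximal S′∉F (extend-inside S′ S′⊆L sc′))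
    where
    P′ = patternOf (S′ ∷ toList F)
    sc′ : SelfComplementary (map P′ L)
    sc′ = begin
      map P′ L                   ≈⟨ ≈-map P′ (≈-sym (involution-≈ unique σ-∈ σ-involutive)) ⟩
      map P′ (map σ L)           ≡⟨ sym (map-∘ L) ⟩
      map (P′ ∘ σ) L             ≈⟨ map-cong-≈ L (λ e e∈ → cong₂ _∷_ (flips′ e∈) (proj₂ (σ-spec e∈))) ⟩
      map (complement ∘ P′) L    ≡⟨ map-∘ L ⟩
      map complement (map P′ L)  ∎
      where open SetoidReasoning (≈-setoid (Vec Bool (suc (length (toList F)))))

  -- All members of F have α elements (take Γ = [S] in the defining equation).
  member-size : ∀ {S} → S ∈ᶜ F → length (proj₁ S) ≡ α
  member-size {S} S∈F = *-cancelˡ-≡ (length (proj₁ S)) α 2 (begin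
    2 * length (proj₁ S)                      ≡⟨ cong (length (proj₁ S) +_) (+-identityʳ _) ⟩
    length (proj₁ S) + length (proj₁ S)       ≡⟨ cong₂ _+_ (≡-trans size-as-count (count-cong L λ x _ → sym (∨-identityʳ _)))
                                                            (≡-trans size-as-count (count-cong L λ x _ → sym (∧-identityʳ _))) ⟩
    count (λ x → any (x ∈ₛᵇ_) [ S ]) L + count (λ x → all (x ∈ₛᵇ_) [ S ]) L
      ≡⟨ sym (cong₂ _+_ (unionSize-count Γ unique ⋃Γ⊆L) (interSize-count Γ unique ⋃Γ⊆L)) ⟩
    unionSize Γ + interSize Γ                 ≡⟨ proj₂ hke Γ (S∈F ∷ []) ⟩
    2 * α                                     ∎)
    where
    open ≡-Reasoning
    Γ : Collection
    Γ = S ∷ []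
    ⋃Γ⊆L : ∀ {x R} → R ∈ᶜ Γ → x ∈ₛ R → x ∈ L
    ⋃Γ⊆L (here refl) x∈S = complete (S , S∈F , x∈S)
    size-as-count : length (proj₁ S) ≡ count (_∈ₛᵇ S) L
    size-as-count = length-as-count unique (elements-unique S) (⋃Γ⊆L (here refl))

record TransversalFamily (F : Collection) (α : ℕ) : Set where
  field
    points        : List ℕ
    enumerates    : Enumerates F points
    σ             : ℕ → ℕ
    σ-∈           : ∀ {e} → e ∈ points → σ e ∈ points
    σ-involutive  : ∀ {e} → e ∈ points → σ (σ e) ≡ e
    flips         : ∀ {S e} → S ∈ᶜ F → e ∈ points → σ e ∈ₛᵇ S ≡ not (e ∈ₛᵇ S)
    transversal-∈ : ∀ S → (∀ {e} → e ∈ₛ S → e ∈ points) →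
                    (∀ {e} → e ∈ points → σ e ∈ₛᵇ S ≡ not (e ∈ₛᵇ S)) → S ∈ᶜ F
    member-size   : ∀ {S} → S ∈ᶜ F → length (proj₁ S) ≡ α
  open Enumerates enumerates public

maximal-structure : ∀ {F α} → Maximal F → IsHKE F α → TransversalFamily F α
maximal-structure maximal hke = record
  { points = L ; enumerates = enum ; σ = σ ; σ-∈ = σ-∈ ; σ-involutive = σ-involutive
  ; flips = flips ; transversal-∈ = transversal-∈ ; member-size = member-size }
  where open MaximalStructure maximal hke

pullback : ∀ {F G α β} (A : TransversalFamily F α) (B : TransversalFamily G β) (k : ℕ → ℕ) →
  (let module A = TransversalFamily A; module B = TransversalFamily B) →
  (∀ {y} → y ∈ B.points → k y ∈ A.points) → (∀ {y} → y ∈ B.points → k (B.σ y) ≡ A.σ (k y)) →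
  ∀ {S} → S ∈ᶜ F → ∃[ S′ ] (S′ ∈ᶜ G × (∀ y → y ∈ₛ S′ ⇔ (y ∈ B.points × k y ∈ₛ S)))
pullback {F} {G} A B k k-∈ k-σ {S} S∈F = S′ , S′∈G , λ y → mk⇔ (to y) (from y)
  where
  module A = TransversalFamily A
  module B = TransversalFamily B
  S′ = setOf (λ y → y ∈ᵇ B.points ∧ k y ∈ₛᵇ S) (bound B.points)

  S′-∈ᵇ : ∀ {y} → y ∈ B.points → y ∈ₛᵇ S′ ≡ k y ∈ₛᵇ S
  S′-∈ᵇ {y} y∈ = ≡-trans (setOf-∈ᵇ _ _ (<-bound B.points y∈)) (cong (_∧ k y ∈ₛᵇ S) (dec-true (y ∈? B.points) y∈))

  to : ∀ y → y ∈ₛ S′ → y ∈ B.points × k y ∈ₛ S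
  to y y∈ = let in-points , in-S = Equivalence.to T-∧ (Equivalence.from T-≡ (setOf-⊆ _ _ y∈)) in
    Equivalence.to ∈ᵇ-T in-points , Equivalence.to ∈ᵇ-T in-S

  from : ∀ y → y ∈ B.points × k y ∈ₛ S → y ∈ₛ S′
  from y (y∈ , ky∈S) = ∈ᵇ⇒∈ (≡-trans (S′-∈ᵇ y∈) (dec-true (k y ∈? proj₁ S) ky∈S))

  S′∈G : S′ ∈ᶜ G
  S′∈G = B.transversal-∈ S′ (proj₁ ∘ to _) λ {y} y∈ → begin
    B.σ y ∈ₛᵇ S′        ≡⟨ S′-∈ᵇ (B.σ-∈ y∈) ⟩
    k (B.σ y) ∈ₛᵇ S     ≡⟨ cong (_∈ₛᵇ S) (k-σ y∈) ⟩
    A.σ (k y) ∈ₛᵇ S     ≡⟨ A.flips S∈F (k-∈ y∈) ⟩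
    not (k y ∈ₛᵇ S)     ≡⟨ cong not (sym (S′-∈ᵇ y∈)) ⟩
    not (y ∈ₛᵇ S′)      ∎
    where open ≡-Reasoning

pairUp : List ℕ → List ℕ → ℕ → ℕ
pairUp []       _        x = x
pairUp (a ∷ as) []       x = x
pairUp (a ∷ as) (b ∷ bs) x = if does (x ≟ a) then b else pairUp as bs x

pairUp-∈ : ∀ {as bs x} → length as ≡ length bs → x ∈ as → pairUp as bs x ∈ bs
pairUp-∈ {a ∷ as} {b ∷ bs} {x} len x∈ with does (x ≟ a) in x≟a
... | true  = here refl
... | false = there (pairUp-∈ (suc-injective len) (Any.tail (does-false (x ≟ a) x≟a) x∈))

pairUp-inverse : ∀ {as bs x} → Unique as → Unique bs → length as ≡ length bs → x ∈ as →
  pairUp bs as (pairUp as bs x) ≡ x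
pairUp-inverse {a ∷ as} {b ∷ bs} {x} (_ ∷ as!) (b∉bs ∷ bs!) len x∈ with does (x ≟ a) in x≟a
... | true  = ≡-trans (cong (λ c → if c then a else pairUp bs as b) (dec-true (b ≟ b) refl))
                      (sym (does-true (x ≟ a) x≟a))
... | false = ≡-trans (cong (λ c → if c then a else pairUp bs as y) (dec-false (y ≟ b) y≢b))
                      (pairUp-inverse as! bs! (suc-injective len) x∈as)
  where
  x∈as : x ∈ as
  x∈as = Any.tail (does-false (x ≟ a) x≟a) x∈
  y = pairUp as bs x
  y≢b : y ≢ b
  y≢b y≡b = All.lookup b∉bs (pairUp-∈ (suc-injective len) x∈as) (sym y≡b)

module Matching {F G α} (A : TransversalFamily F α) (B : TransversalFamily G α) where
  private
    module A = TransversalFamily A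
    module B = TransversalFamily B

  S₀ = List⁺.head F
  R₀ = List⁺.head G

  same-length : length (proj₁ S₀) ≡ length (proj₁ R₀)
  same-length = ≡-trans (A.member-size (here refl)) (sym (B.member-size (here refl)))

  pair : ℕ → ℕ
  pair = pairUp (proj₁ S₀) (proj₁ R₀)

  pair-∈ : ∀ {x} → x ∈ₛ S₀ → pair x ∈ₛ R₀
  pair-∈ = pairUp-∈ same-length

  g : ℕ → ℕ
  g x = if x ∈ₛᵇ S₀ then pair x else B.σ (pair (A.σ x))

  σ-into-S₀ : ∀ {x} → x ∈ A.points → x ∈ₛᵇ S₀ ≡ false → A.σ x ∈ₛ S₀
  σ-into-S₀ x∈ x∉ = ∈ᵇ⇒∈ (≡-trans (A.flips (here refl) x∈) (cong not x∉))

  R₀⊆ : ∀ {y} → y ∈ₛ R₀ → y ∈ B.points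
  R₀⊆ y∈ = B.complete (R₀ , here refl , y∈)

  g-∈ : ∀ {x} → x ∈ A.points → g x ∈ B.points
  g-∈ {x} x∈ with x ∈ₛᵇ S₀ in x-in
  ... | true  = R₀⊆ (pair-∈ (∈ᵇ⇒∈ x-in))
  ... | false = B.σ-∈ (R₀⊆ (pair-∈ (σ-into-S₀ x∈ x-in)))

  g-σ : ∀ {x} → x ∈ A.points → g (A.σ x) ≡ B.σ (g x)
  g-σ {x} x∈ with x ∈ₛᵇ S₀ in x-in
  ... | true  = begin
    g (A.σ x)                             ≡⟨ cong (λ c → if c then pair (A.σ x) else B.σ (pair (A.σ (A.σ x))))
                                                  (≡-trans (A.flips (here refl) x∈) (cong not x-in)) ⟩
    B.σ (pair (A.σ (A.σ x)))              ≡⟨ cong (B.σ ∘ pair) (A.σ-involutive x∈) ⟩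
    B.σ (pair x)                          ∎
    where open ≡-Reasoning
  ... | false = begin
    g (A.σ x)                             ≡⟨ cong (λ c → if c then pair (A.σ x) else B.σ (pair (A.σ (A.σ x))))
                                                  (≡-trans (A.flips (here refl) x∈) (cong not x-in)) ⟩
    pair (A.σ x)                          ≡⟨ sym (B.σ-involutive (R₀⊆ (pair-∈ (σ-into-S₀ x∈ x-in)))) ⟩
    B.σ (B.σ (pair (A.σ x)))              ∎
    where open ≡-Reasoning

module _ {F G α} (A : TransversalFamily F α) (B : TransversalFamily G α) where
  private
    module A = TransversalFamily A
    module B = TransversalFamily B
    module AB = Matching A B
    module BA = Matching B A

  matching-inverse : ∀ {x} → x ∈ A.points → BA.g (AB.g x) ≡ x
  matching-inverse {x} x∈ with x ∈ₛᵇ AB.S₀ in x-in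
  ... | true  = begin
    BA.g y             ≡⟨ cong (λ c → if c then BA.pair y else A.σ (BA.pair (B.σ y))) (dec-true (y ∈? proj₁ AB.R₀) y∈R₀) ⟩
    BA.pair y          ≡⟨ pairUp-inverse (elements-unique AB.S₀) (elements-unique AB.R₀) AB.same-length x∈S₀ ⟩
    x                  ∎
    where
    open ≡-Reasoning
    x∈S₀ = ∈ᵇ⇒∈ x-in
    y = AB.pair x
    y∈R₀ = AB.pair-∈ x∈S₀
  ... | false = begin
    BA.g (B.σ y)                 ≡⟨ cong (λ c → if c then BA.pair (B.σ y) else A.σ (BA.pair (B.σ (B.σ y)))) σy∉R₀ ⟩
    A.σ (BA.pair (B.σ (B.σ y)))  ≡⟨ cong (A.σ ∘ BA.pair) (B.σ-involutive (AB.R₀⊆ y∈R₀)) ⟩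
    A.σ (BA.pair y)              ≡⟨ cong A.σ (pairUp-inverse (elements-unique AB.S₀) (elements-unique AB.R₀) AB.same-length σx∈S₀) ⟩
    A.σ (A.σ x)                  ≡⟨ A.σ-involutive x∈ ⟩
    x                            ∎
    where
    open ≡-Reasoning
    σx∈S₀ = AB.σ-into-S₀ x∈ x-in
    y = AB.pair (A.σ x)
    y∈R₀ = AB.pair-∈ σx∈S₀
    σy∉R₀ : B.σ y ∈ₛᵇ AB.R₀ ≡ false
    σy∉R₀ = ≡-trans (B.flips (here refl) (AB.R₀⊆ y∈R₀)) (cong not (dec-true (y ∈? proj₁ AB.R₀) y∈R₀))

transversal-families-isomorphic : ∀ {F₁ F₂ α} → TransversalFamily F₁ α → TransversalFamily F₂ α → Isomorphic F₁ F₂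
transversal-families-isomorphic {F₁} {F₂} A B = record
  { g          = AB.g
  ; maps       = λ x x∈ → B.sound (AB.g-∈ (A.complete x∈))
  ; injective  = λ x y x∈ y∈ gx≡gy → ≡-trans (sym (back x∈)) (≡-trans (cong BA.g gx≡gy) (back y∈))
  ; surjective = λ y y∈ → BA.g y , A.sound (BA.g-∈ (B.complete y∈)) , forth y∈
  ; image      = image
  ; preimage   = preimage
  }
  where
  module A = TransversalFamily A
  module B = TransversalFamily B
  module AB = Matching A B
  module BA = Matching B A

  back : ∀ {x} → x ∈⋃ F₁ → BA.g (AB.g x) ≡ x
  back x∈ = matching-inverse A B (A.complete x∈)

  forth : ∀ {y} → y ∈⋃ F₂ → AB.g (BA.g y) ≡ y
  forth y∈ = matching-inverse B A (B.complete y∈)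

  image : ∀ S → S ∈ᶜ F₁ → ∃[ T′ ] (T′ ∈ᶜ F₂ × (∀ y → y ∈ₛ T′ ⇔ (∃[ x ] (x ∈ₛ S × AB.g x ≡ y))))
  image S S∈F₁ with pullback A B BA.g BA.g-∈ BA.g-σ S∈F₁
  ... | T′ , T′∈F₂ , T′⇔ = T′ , T′∈F₂ , λ y → mk⇔ (to y) (from y)
    where
    to : ∀ y → y ∈ₛ T′ → ∃[ x ] (x ∈ₛ S × AB.g x ≡ y)
    to y y∈T′ = let y∈ , hy∈S = Equivalence.to (T′⇔ y) y∈T′ in BA.g y , hy∈S , matching-inverse B A y∈
    from : ∀ y → ∃[ x ] (x ∈ₛ S × AB.g x ≡ y) → y ∈ₛ T′
    from y (x , x∈S , refl) = let x∈ = A.complete (S , S∈F₁ , x∈S) in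
      Equivalence.from (T′⇔ y) (AB.g-∈ x∈ , subst (_∈ₛ S) (sym (matching-inverse A B x∈)) x∈S)

  preimage : ∀ S → S ∈ᶜ F₂ → ∃[ T′ ] (T′ ∈ᶜ F₁ × (∀ x → x ∈⋃ F₁ → (x ∈ₛ T′ ⇔ AB.g x ∈ₛ S)))
  preimage S S∈F₂ with pullback B A AB.g AB.g-∈ AB.g-σ S∈F₂
  ... | T′ , T′∈F₁ , T′⇔ = T′ , T′∈F₁ , λ x x∈ →
    mk⇔ (proj₂ ∘ Equivalence.to (T′⇔ x)) (λ gx∈S → Equivalence.from (T′⇔ x) (A.complete x∈ , gx∈S))

mainTheorem2 : (F₁ F₂ : Collection) (α : ℕ) → Maximal F₁ → Maximal F₂ → IsHKE F₁ α → IsHKE F₂ α → Isomorphic F₁ F₂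
mainTheorem2 F₁ F₂ α maximal₁ maximal₂ hke₁ hke₂ =
  transversal-families-isomorphic (maximal-structure maximal₁ hke₁) (maximal-structure maximal₂ hke₂)
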